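{- Let $G$ be a connected graph, let $N$ be a regular tree set of finite-order separations of $G$ such that all separators of separations in $N$ induce cliques in $G$, let $O$ be a consistent orientation of $N$, and let $\Pi=\bigcap_{(C,D)\in O}D$. Then for every corridor $\gamma$ of $O$ the set $A_\gamma\cap\Pi$ induces a clique in $G$.
   Context: A separation of $G=(V,E)$ is $\{A,B\}$ with $A\cup B=V$ and no edge between $A\setminus B$ and $B\setminus A$; separator $A\cap B$, order $|A\cap B|$. Orientations $(A,B),(B,A)$ (mutually inverse) are ordered by $(A,B)\le(C,D)$ iff $A\subseteq C$, $B\supseteq D$. A tree set is a set $N$ of separations any two of which have comparable orientations, with no orientation that is degenerate ($\vec r=\overleftarrow r$) or trivial (there is $s\in N$, $s\ne r$, with $\vec r<\vec s$ and $\vec r<\overleftarrow s$); regular if no orientation is small ($\vec r\le\overleftarrow r$). An orientation $O$ of $N$ contains exactly one orientation of each separation; consistent if there are no distinct $r,s$ with orientations $\vec r<\vec s$ and $\overleftarrow r,\vec s\in O$. On $O$, $(C,D)\sim(C',D')$ iff some separation of $O$ is $\ge$ both; this is an equivalence relation, and its equivalence classes are the corridors of $O$. For a corridor $\gamma$, $A_\gamma$ is the union of all sets $C$ with $(C,D)\in\gamma$. -}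

module Defs where

open import Data.Bool using (Bool; true; false; not)
open import Data.Empty using (⊥)
open import Data.Product using (Σ; ∃; _×_; _,_)
open import Data.Sum using (_⊎_)
open import Data.List using (List)
open import Data.List.Membership.Propositional using (_∈_)
open import Relation.Nullary using (¬_)
open import Relation.Binary.PropositionalEquality using (_≡_; _≢_)

Subset : Set → Set₁
Subset V = V → Set

_⊆_ : {V : Set} → Subset V → Subset V → Set
X ⊆ Y = ∀ v → X v → Y v

_≐_ : {V : Set} → Subset V → Subset V → Set
X ≐ Y = (X ⊆ Y) × (Y ⊆ X)

_∩_ : {V : Set} → Subset V → Subset V → Subset V
(X ∩ Y) v = X v × Y v

Finite : {V : Set} → Subset V → Set
Finite {V} X = Σ (List V) λ xs → ∀ v → X v → v ∈ xs

record Graph : Set₁ where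
  field
    V      : Set
    E      : V → V → Set
    E-sym  : ∀ {x y} → E x y → E y x
    E-irr  : ∀ x → ¬ E x x

data Walk (G : Graph) : Graph.V G → Graph.V G → Set where
  here : ∀ {x} → Walk G x x
  step : ∀ {x y z} → Graph.E G x y → Walk G y z → Walk G x z

Connected : Graph → Set
Connected G = ∀ (x y : Graph.V G) → Walk G x y

IsClique : (G : Graph) → Subset (Graph.V G) → Set
IsClique G X = ∀ x y → X x → X y → x ≢ y → Graph.E G x y

record OSep (V : Set) : Set₁ where
  constructor ⟨_,_⟩
  field
    A : Subset V
    B : Subset V
open OSep public

_* : {V : Set} → OSep V → OSep V
⟨ X , Y ⟩ * = ⟨ Y , X ⟩

Separator : {V : Set} → OSep V → Subset V
Separator s = A s ∩ B s

_≤ₛ_ : {V : Set} → OSep V → OSep V → Set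
r ≤ₛ s = (A r ⊆ A s) × (B s ⊆ B r)

_≈ₛ_ : {V : Set} → OSep V → OSep V → Set
r ≈ₛ s = (A r ≐ A s) × (B r ≐ B s)

_<ₛ_ : {V : Set} → OSep V → OSep V → Set
r <ₛ s = (r ≤ₛ s) × ¬ (r ≈ₛ s)

IsSeparation : (G : Graph) → OSep (Graph.V G) → Set
IsSeparation G s =
  (∀ v → A s v ⊎ B s v) ×
  (∀ x y → A s x → ¬ B s x → B s y → ¬ A s y → ¬ Graph.E G x y)

-- A set N of separations, presented as a family indexed by I, together
-- with a reference orientation of each member. Distinct indices denote
-- distinct separations (injectivity up to equality of separations, in
-- either orientation), so I is in bijection with the set N.
record SepSet (V : Set) : Set₁ where
  field
    I   : Set
    sep : I → OSep V

orient : {V : Set} (N : SepSet V) → SepSet.I N → Bool → OSep V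
orient N i true  = SepSet.sep N i
orient N i false = SepSet.sep N i *

IsInjective : {V : Set} → SepSet V → Set
IsInjective N = ∀ i j b → orient N i true ≈ₛ orient N j b → i ≡ j

Nested : {V : Set} → SepSet V → Set
Nested N = ∀ i j → Σ Bool λ b → Σ Bool λ b' → orient N i b ≤ₛ orient N j b'

NoDegenerate : {V : Set} → SepSet V → Set
NoDegenerate N = ∀ i → ¬ (orient N i true ≈ₛ orient N i false)

NoTrivial : {V : Set} → SepSet V → Set
NoTrivial N = ∀ i b j → j ≢ i →
  ¬ ((orient N i b <ₛ orient N j true) × (orient N i b <ₛ orient N j false))

IsTreeSet : {V : Set} → SepSet V → Set
IsTreeSet N = Nested N × NoDegenerate N × NoTrivial N

IsRegular : {V : Set} → SepSet V → Set
IsRegular N = ∀ i b → ¬ (orient N i b ≤ₛ orient N i (not b))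

-- Orientations of N: a choice of one of the two orientations for each
-- separation of N; the chosen oriented separation of i is  chosen N o i.
Orientation : {V : Set} → SepSet V → Set
Orientation N = SepSet.I N → Bool

chosen : {V : Set} (N : SepSet V) → Orientation N → SepSet.I N → OSep V
chosen N o i = orient N i (o i)

Consistent : {V : Set} (N : SepSet V) → Orientation N → Set
Consistent N o = ∀ i j b b' → i ≢ j → orient N i b <ₛ orient N j b' →
  o i ≡ not b → o j ≡ b' → ⊥

Corr : {V : Set} (N : SepSet V) → Orientation N → SepSet.I N → SepSet.I N → Set
Corr N o i j = Σ (SepSet.I N) λ k →
  (chosen N o i ≤ₛ chosen N o k) × (chosen N o j ≤ₛ chosen N o k)

-- corridors: equivalence classes of ∼ (as sets of members of O, indexed by I)
IsCorridor : {V : Set} (N : SepSet V) (o : Orientation N) → (SepSet.I N → Set) → Set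
IsCorridor N o γ = Σ (SepSet.I N) λ i₀ → ∀ j → (γ j → Corr N o j i₀) × (Corr N o j i₀ → γ j)

A[_,_,_] : {V : Set} (N : SepSet V) (o : Orientation N) → (SepSet.I N → Set) → Subset V
A[ N , o , γ ] v = Σ (SepSet.I N) λ j → γ j × A (chosen N o j) v

Π[_,_] : {V : Set} (N : SepSet V) (o : Orientation N) → Subset V
Π[ N , o ] v = ∀ i → B (chosen N o i) v

module Submission where

-- Fix a corridor γ of the orientation O, with base
-- separation t ∈ O.  Every vertex x of A_γ lies in A r for some r ∈ O
-- with t ≤ r (the separation witnessing r' ∼ t for the member r' of γ
-- containing x).  Given x ∈ A r ∩ Π and y ∈ A s ∩ Π with t ≤ r, t ≤ s,
-- nestedness makes r and s comparable; the case r ≤ s⃖ is impossible,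
-- since then t would lie below both orientations of s, i.e. be trivial
-- (regularity rules out the boundary cases t = s, t = s⃖).  In each
-- remaining case both x and y lie in A q ∩ Π for one q ∈ {r, s}.  Finally
-- A q ∩ Π ⊆ A q ∩ B q, the separator of q, which is a clique.

open import Defs
open import Data.Bool using (true; false)
open import Data.Empty using (⊥; ⊥-elim)
open import Data.Product using (Σ; _×_; _,_; proj₁; proj₂)
open import Data.Sum using (_⊎_; inj₁; inj₂)
open import Relation.Nullary using (¬_)
open import Relation.Binary.PropositionalEquality using (_≢_; refl)

module OrientedSeparations {V : Set} where

  ≤ₛ-trans : {r s t : OSep V} → r ≤ₛ s → s ≤ₛ t → r ≤ₛ t
  ≤ₛ-trans (r⊆s , s⊇r) (s⊆t , t⊇s) =
    (λ v p → s⊆t v (r⊆s v p)) , (λ v p → s⊇r v (t⊇s v p))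

  ≈ₛ-refl : {r : OSep V} → r ≈ₛ r
  ≈ₛ-refl = ((λ _ p → p) , (λ _ p → p)) , ((λ _ p → p) , (λ _ p → p))

  ≈ₛ⇒≥ₛ : {r s : OSep V} → r ≈ₛ s → s ≤ₛ r
  ≈ₛ⇒≥ₛ ((_ , As⊆Ar) , (Br⊆Bs , _)) = As⊆Ar , Br⊆Bs

  *-antitone : {r s : OSep V} → r ≤ₛ s → (s *) ≤ₛ (r *)
  *-antitone (Ar⊆As , Bs⊆Br) = Bs⊆Br , Ar⊆As

  -- r and s have comparable orientations.  Since (r *) * is r
  -- definitionally, this relation is invariant under inverting either side.
  Comparable : OSep V → OSep V → Set
  Comparable r s = (r ≤ₛ s) ⊎ (r ≤ₛ (s *)) ⊎ ((r *) ≤ₛ s) ⊎ ((r *) ≤ₛ (s *))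

  comparable-*ˡ : {r s : OSep V} → Comparable r s → Comparable (r *) s
  comparable-*ˡ (inj₁ p)               = inj₂ (inj₂ (inj₁ p))
  comparable-*ˡ (inj₂ (inj₁ p))        = inj₂ (inj₂ (inj₂ p))
  comparable-*ˡ (inj₂ (inj₂ (inj₁ p))) = inj₁ p
  comparable-*ˡ (inj₂ (inj₂ (inj₂ p))) = inj₂ (inj₁ p)

  comparable-*ʳ : {r s : OSep V} → Comparable r s → Comparable r (s *)
  comparable-*ʳ (inj₁ p)               = inj₂ (inj₁ p)
  comparable-*ʳ (inj₂ (inj₁ p))        = inj₁ p
  comparable-*ʳ (inj₂ (inj₂ (inj₁ p))) = inj₂ (inj₂ (inj₂ p))
  comparable-*ʳ (inj₂ (inj₂ (inj₂ p))) = inj₂ (inj₂ (inj₁ p))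

open OrientedSeparations

module Orientations {V : Set} (N : SepSet V) where

  orient-flip : ∀ k b c →
    (orient N k c ≈ₛ orient N k b) ⊎ (orient N k c ≈ₛ (orient N k b *))
  orient-flip k true  true  = inj₁ ≈ₛ-refl
  orient-flip k true  false = inj₂ ≈ₛ-refl
  orient-flip k false true  = inj₂ ≈ₛ-refl
  orient-flip k false false = inj₁ ≈ₛ-refl

  comparable-reorientˡ : ∀ {s} k b c → Comparable (orient N k c) s → Comparable (orient N k b) s
  comparable-reorientˡ k true  true  = λ p → p
  comparable-reorientˡ k true  false = comparable-*ˡ
  comparable-reorientˡ k false true  = comparable-*ˡ
  comparable-reorientˡ k false false = λ p → p

  comparable-reorientʳ : ∀ {r} k b c → Comparable r (orient N k c) → Comparable r (orient N k b)
  comparable-reorientʳ k true  true  = λ p → p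
  comparable-reorientʳ k true  false = comparable-*ʳ
  comparable-reorientʳ k false true  = comparable-*ʳ
  comparable-reorientʳ k false false = λ p → p

  nested-comparable : Nested N → ∀ i j b b' → Comparable (orient N i b) (orient N j b')
  nested-comparable nest i j b b' with nest i j
  ... | c , c' , le = comparable-reorientˡ i b c (comparable-reorientʳ j b' c' (inj₁ le))

  not-small : IsRegular N → ∀ k b → ¬ (orient N k b ≤ₛ (orient N k b *))
  not-small reg k true  = reg k true
  not-small reg k false = reg k false

  not-co-small : IsRegular N → ∀ k b → ¬ ((orient N k b *) ≤ₛ orient N k b)
  not-co-small reg k true  = reg k false
  not-co-small reg k false = reg k true

  -- Regularity excludes t = s and
  -- t = s⃖ (which also rules out t and s being the same separation), so
  -- t would lie strictly below both, i.e. be trivial.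
  not-below-both : IsRegular N → NoTrivial N → ∀ i c k b →
    orient N i c ≤ₛ orient N k b → orient N i c ≤ₛ (orient N k b *) → ⊥
  not-below-both reg ntr i c k b t≤s t≤s* =
    ntr i c k k≢i (strictly-below-both b t≤s t≤s* t≉s t≉s*)
    where
    t = orient N i c
    s = orient N k b
    t≉s : ¬ (t ≈ₛ s)
    t≉s t≈s = not-small reg k b (≤ₛ-trans (≈ₛ⇒≥ₛ t≈s) t≤s*)
    t≉s* : ¬ (t ≈ₛ (s *))
    t≉s* t≈s* = not-co-small reg k b (≤ₛ-trans (≈ₛ⇒≥ₛ t≈s*) t≤s)
    k≢i : k ≢ i
    k≢i refl with orient-flip k b c
    ... | inj₁ t≈s  = t≉s t≈s
    ... | inj₂ t≈s* = t≉s* t≈s*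
    strictly-below-both : ∀ b → t ≤ₛ orient N k b → t ≤ₛ (orient N k b *) →
      ¬ (t ≈ₛ orient N k b) → ¬ (t ≈ₛ (orient N k b *)) →
      (t <ₛ orient N k true) × (t <ₛ orient N k false)
    strictly-below-both true  p q p≉ q≉ = (p , p≉) , (q , q≉)
    strictly-below-both false p q p≉ q≉ = (q , q≉) , (p , p≉)

  separator-orient : ∀ k b v → A (orient N k b) v → B (orient N k b) v →
    Separator (SepSet.sep N k) v
  separator-orient k true  v a b = a , b
  separator-orient k false v a b = b , a

open Orientations

module CorridorSides {V : Set} (N : SepSet V) (o : Orientation N) where

  corridor-side : (γ : SepSet.I N → Set) (corridor : IsCorridor N o γ) →
    ∀ v → A[ N , o , γ ] v →
    Σ (SepSet.I N) λ k → (chosen N o (proj₁ corridor) ≤ₛ chosen N o k) × A (chosen N o k) v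
  corridor-side γ (i₀ , γ≡∼i₀) v (j , γj , v∈Aj) with proj₁ (γ≡∼i₀ j) γj
  ... | k , j≤k , i₀≤k = k , i₀≤k , proj₁ j≤k v v∈Aj

  common-side : Nested N → IsRegular N → NoTrivial N →
    ∀ i₀ k₁ k₂ x y →
    chosen N o i₀ ≤ₛ chosen N o k₁ → chosen N o i₀ ≤ₛ chosen N o k₂ →
    A (chosen N o k₁) x → Π[ N , o ] x → A (chosen N o k₂) y → Π[ N , o ] y →
    Σ (SepSet.I N) λ q → (A (chosen N o q) ∩ Π[ N , o ]) x × (A (chosen N o q) ∩ Π[ N , o ]) y
  common-side nest reg ntr i₀ k₁ k₂ x y t≤r t≤s x∈Ar Πx y∈As Πy
    with nested-comparable N nest k₁ k₂ (o k₁) (o k₂)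
  ... | inj₁ r≤s               = k₂ , (proj₁ r≤s x x∈Ar , Πx) , (y∈As , Πy)
  ... | inj₂ (inj₁ r≤s*)       =
    ⊥-elim (not-below-both N reg ntr i₀ (o i₀) k₂ (o k₂) t≤s (≤ₛ-trans t≤r r≤s*))
  ... | inj₂ (inj₂ (inj₁ r*≤s)) = k₂ , (proj₁ r*≤s x (Πx k₁) , Πx) , (y∈As , Πy)
  ... | inj₂ (inj₂ (inj₂ r*≤s*)) =
    k₁ , (x∈Ar , Πx) , (proj₁ (*-antitone r*≤s*) y y∈As , Πy)

-- If all separators are cliques, then so is A q ∩ Π for every q ∈ O,
-- because A q ∩ Π is contained in A q ∩ B q.
side∩Π-clique : (G : Graph) (N : SepSet (Graph.V G)) (o : Orientation N) →
  (∀ i → IsClique G (Separator (SepSet.sep N i))) →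
  ∀ q → IsClique G (A (chosen N o q) ∩ Π[ N , o ])
side∩Π-clique G N o cl q x y (x∈A , Πx) (y∈A , Πy) =
  cl q x y (separator-orient N q (o q) x x∈A (Πx q)) (separator-orient N q (o q) y y∈A (Πy q))

open CorridorSides

-- The argument needs only nestedness, regularity, absence of
-- trivial separations and cliqueness of the separators; connectivity,
-- finiteness of orders, injectivity of N and consistency of O are unused.
lemma7p11 : (G : Graph) → Connected G →
    (N : SepSet (Graph.V G)) → IsInjective N →
    (∀ i → IsSeparation G (SepSet.sep N i)) →
    IsTreeSet N → IsRegular N →
    (∀ i → Finite (Separator (SepSet.sep N i))) →
    (∀ i → IsClique G (Separator (SepSet.sep N i))) →
    (o : Orientation N) → Consistent N o →
    (γ : SepSet.I N → Set) → IsCorridor N o γ →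
    IsClique G (A[ N , o , γ ] ∩ Π[ N , o ])
lemma7p11 G _ N _ _ (nest , _ , ntr) reg _ cl o _ γ corridor x y (x∈Aγ , Πx) (y∈Aγ , Πy) x≢y
  with corridor-side N o γ corridor x x∈Aγ | corridor-side N o γ corridor y y∈Aγ
... | k₁ , t≤r , x∈Ar | k₂ , t≤s , y∈As
  with common-side N o nest reg ntr (proj₁ corridor) k₁ k₂ x y t≤r t≤s x∈Ar Πx y∈As Πy
... | q , x∈q , y∈q = side∩Π-clique G N o cl q x y x∈q y∈q x≢y
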